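{- The immediate scheduler and the pairwise immediate scheduler are equivalent: for every team strategy (choice of words $\pi_1,\dots,\pi_n$ over $[m]$) in the Musical Chairs game, the immediate scheduler can produce an infinite execution that never reaches a conflict-free configuration if and only if the pairwise immediate scheduler can.
   Context: Musical Chairs game: $n$ players each with a deterministic word $\pi_i$ over the chairs $[m]$ (infinite, or finite and traversed cyclically); the scheduler chooses starting positions. A player is in conflict if another player occupies the same chair. When a player is moved, it advances to the next letter of its word. A configuration is conflict-free if no two players share a chair; the scheduler wins if it generates an infinite execution that never reaches a conflict-free configuration. The immediate scheduler may, in each round, select an arbitrary nonempty set of players currently in conflict and move them all. The pairwise immediate scheduler may, in each round, select two distinct players $P\ne Q$ currently occupying the same chair and move either $P$, or $Q$, or both. Two schedulers are equivalent if for every team strategy one has a winning strategy iff the other does. -}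

module Defs where

open import Data.Nat using (ℕ; suc)
open import Data.Fin using (Fin; _≟_)
open import Data.Bool using (Bool; true; false; if_then_else_)
open import Data.Product using (Σ; ∃; ∃-syntax; _×_)
open import Data.Sum using (_⊎_)
open import Relation.Nullary using (¬_)
open import Relation.Nullary.Decidable using (⌊_⌋)
open import Relation.Binary.PropositionalEquality using (_≡_; _≢_)

-- A team strategy: player i (of n) has a deterministic infinite word over the
-- chairs [m] = Fin m.  A finite word traversed cyclically is the periodic
-- infinite word it generates, so this covers both cases.
Strategy : ℕ → ℕ → Set
Strategy n m = Fin n → ℕ → Fin m

-- A configuration records, for each player, its current position in its word.
Config : ℕ → Set
Config n = Fin n → ℕ

module _ {n m : ℕ} (π : Strategy n m) where

  chair : Config n → Fin n → Fin m
  chair c i = π i (c i)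

  InConflict : Config n → Fin n → Set
  InConflict c i = ∃[ j ] (j ≢ i × chair c j ≡ chair c i)

  ConflictFree : Config n → Set
  ConflictFree c = ∀ i j → i ≢ j → chair c i ≢ chair c j

  advance : Config n → (Fin n → Bool) → Config n
  advance c S i = if S i then suc (c i) else c i

  ImmStep : Config n → Config n → Set
  ImmStep c c' = Σ (Fin n → Bool) λ S →
    (∃[ i ] S i ≡ true) × (∀ i → S i ≡ true → InConflict c i) × (∀ i → c' i ≡ advance c S i)

  single : Fin n → Fin n → Bool
  single P i = ⌊ i ≟ P ⌋

  pair : Fin n → Fin n → Fin n → Bool
  pair P Q i = if ⌊ i ≟ P ⌋ then true else ⌊ i ≟ Q ⌋

  PairStep : Config n → Config n → Set
  PairStep c c' = ∃[ P ] ∃[ Q ] (P ≢ Q × chair c P ≡ chair c Q ×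
    ((∀ i → c' i ≡ advance c (single P) i) ⊎ (∀ i → c' i ≡ advance c (single Q) i) ⊎
     (∀ i → c' i ≡ advance c (pair P Q) i)))

  Wins : (Config n → Config n → Set) → Set
  Wins Step = Σ (ℕ → Config n) λ e → ((∀ (t : ℕ) → Step (e t) (e (suc t))) × (∀ (t : ℕ) → ¬ ConflictFree (e t)))

  ImmediateWins : Set
  ImmediateWins = Wins ImmStep

  PairwiseWins : Set
  PairwiseWins = Wins PairStep

module Submission where

-- Pairwise ⇒ immediate is immediate: a pairwise step moves a nonempty subset
-- of two players sharing a chair, both of which are in conflict.
--
-- Immediate ⇒ pairwise: one immediate step, moving a set R of conflicting
-- players from c to d, is simulated by a finite sequence of pairwise steps.
-- We track the "partial move" invariant: d arises from the current
-- configuration by advancing some players that are in conflict there.  Given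
-- a pending player a, either every other pending player keeps a conflict
-- partner besides a, and we move a alone; or some pending b conflicts only
-- with a, so a and b share a chair and we move both.  Either way the invariant
-- is preserved.  When nothing is pending we have reached d and continue with
-- the next immediate step, which is nonempty; so an invariant that can always
-- be re-established after one pairwise step yields an infinite pairwise run,
-- and every configuration of such a run is not conflict-free.

open import Defs
open import Data.Nat using (ℕ; zero; suc)
open import Data.Nat.Properties using (1+n≢n) renaming (_≟_ to _≟ℕ_)
open import Data.Fin using (Fin; _≟_)
open import Data.Fin.Properties using (any?)
open import Data.Bool using (Bool; true; false; if_then_else_)
open import Data.Product using (Σ; ∃; ∃-syntax; _×_; _,_; proj₁; proj₂)
open import Data.Sum using (_⊎_; inj₁; inj₂)
open import Data.Empty using (⊥-elim)
open import Function using (_∘_)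
open import Function.Bundles using (_⇔_; mk⇔)
open import Relation.Nullary using (¬_; Dec; yes; no)
open import Relation.Nullary.Decidable using (toSum; ¬?; _×-dec_; decidable-stable)
open import Relation.Binary.PropositionalEquality using (_≡_; _≢_; refl; sym; trans; cong)

infinite-run : {A : Set} {R : A → A → Set} (J : A → Set) →
               (∀ {x} → J x → Σ A λ y → R x y × J y) →
               ∀ {x} → J x → Σ (ℕ → A) λ f → ∀ t → R (f t) (f (suc t))
infinite-run {A} {R} J next {x} jx = proj₁ ∘ states , λ t → proj₁ (proj₂ (next (proj₂ (states t))))
  where
  states : ℕ → Σ A J
  states zero    = x , jx
  states (suc t) = proj₁ (next (proj₂ (states t))) , proj₂ (proj₂ (next (proj₂ (states t))))

module _ {n m : ℕ} (π : Strategy n m) where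

  advance-in : ∀ c S i → S i ≡ true → advance π c S i ≡ suc (c i)
  advance-in c S i h = cong (λ b → if b then suc (c i) else c i) h

  advance-out : ∀ c S i → S i ≡ false → advance π c S i ≡ c i
  advance-out c S i h = cong (λ b → if b then suc (c i) else c i) h

  single-self : ∀ a → single π a a ≡ true
  single-self a with a ≟ a
  ... | yes _  = refl
  ... | no a≢a = ⊥-elim (a≢a refl)

  single-outside : ∀ {a i} → i ≢ a → single π a i ≡ false
  single-outside {a} {i} i≢a with i ≟ a
  ... | yes i≡a = ⊥-elim (i≢a i≡a)
  ... | no _    = refl

  member-single : ∀ {a i} → single π a i ≡ true → i ≡ a
  member-single {a} {i} h with i ≟ a
  member-single h  | yes i≡a = i≡a
  member-single () | no _

  pair-left : ∀ a b → pair π a b a ≡ true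
  pair-left a b with a ≟ a
  ... | yes _  = refl
  ... | no a≢a = ⊥-elim (a≢a refl)

  pair-right : ∀ a b → pair π a b b ≡ true
  pair-right a b with b ≟ a
  ... | yes _ = refl
  ... | no _  = single-self b

  pair-outside : ∀ {a b i} → i ≢ a → i ≢ b → pair π a b i ≡ false
  pair-outside {a} {b} {i} i≢a i≢b with i ≟ a
  ... | yes i≡a = ⊥-elim (i≢a i≡a)
  ... | no _    = single-outside i≢b

  member-pair : ∀ {a b i} → pair π a b i ≡ true → i ≡ a ⊎ i ≡ b
  member-pair {a} {b} {i} h with i ≟ a
  ... | yes i≡a = inj₁ i≡a
  ... | no _    = inj₂ (member-single h)

  conflict-persists : ∀ {c c' i k} → k ≢ i → chair π c k ≡ chair π c i →
                      c' k ≡ c k → c' i ≡ c i → InConflict π c' i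
  conflict-persists {i = i} {k} k≢i same ck ci =
    k , k≢i , trans (cong (π k) ck) (trans same (cong (π i) (sym ci)))

  imm-not-conflict-free : ∀ {c c'} → ImmStep π c c' → ¬ ConflictFree π c
  imm-not-conflict-free (S , (i , Si) , conflicts , _) cf with conflicts i Si
  ... | j , j≢i , same = cf j i j≢i same

  moving-pair-is-immediate : ∀ {c c' P Q} (S : Fin n → Bool) → P ≢ Q → chair π c P ≡ chair π c Q →
                             (∃[ i ] S i ≡ true) → (∀ i → S i ≡ true → i ≡ P ⊎ i ≡ Q) →
                             (∀ i → c' i ≡ advance π c S i) → ImmStep π c c'
  moving-pair-is-immediate {c} {P = P} {Q} S P≢Q same nonempty members moved =
    S , nonempty , conflicts , moved
    where
    conflicts : ∀ i → S i ≡ true → InConflict π c i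
    conflicts i Si with members i Si
    ... | inj₁ refl = Q , P≢Q ∘ sym , sym same
    ... | inj₂ refl = P , P≢Q , same

  pair-step⇒imm-step : ∀ {c c'} → PairStep π c c' → ImmStep π c c'
  pair-step⇒imm-step (P , Q , P≢Q , same , inj₁ moved) =
    moving-pair-is-immediate (single π P) P≢Q same (P , single-self P) (λ _ → inj₁ ∘ member-single) moved
  pair-step⇒imm-step (P , Q , P≢Q , same , inj₂ (inj₁ moved)) =
    moving-pair-is-immediate (single π Q) P≢Q same (Q , single-self Q) (λ _ → inj₂ ∘ member-single) moved
  pair-step⇒imm-step (P , Q , P≢Q , same , inj₂ (inj₂ moved)) =
    moving-pair-is-immediate (pair π P Q) P≢Q same (P , pair-left P Q) (λ _ → member-pair) moved

  pairwise-run-wins : (Σ (ℕ → Config n) λ e → ∀ t → PairStep π (e t) (e (suc t))) → PairwiseWins π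
  pairwise-run-wins (e , steps) = e , steps , λ t → imm-not-conflict-free (pair-step⇒imm-step (steps t))

  PartialMove : Config n → Config n → Set
  PartialMove c d = ∀ i → d i ≡ c i ⊎ (d i ≡ suc (c i) × InConflict π c i)

  Pending : Config n → Config n → Fin n → Set
  Pending c d i = d i ≡ suc (c i)

  NonemptyMove : Config n → Config n → Set
  NonemptyMove c d = PartialMove c d × ∃ (Pending c d)

  imm-nonempty-move : ∀ {c d} → ImmStep π c d → NonemptyMove c d
  imm-nonempty-move {c} {d} (S , (i , Si) , conflicts , moved) =
    partial , i , trans (moved i) (advance-in c S i Si)
    where
    partial : PartialMove c d
    partial j with S j in Sj
    ... | true  = inj₂ (trans (moved j) (advance-in c S j Sj) , conflicts j Sj)
    ... | false = inj₁ (trans (moved j) (advance-out c S j Sj))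

  nonempty-move-≗ : ∀ {c c' d} → (∀ i → c i ≡ c' i) → NonemptyMove c d → NonemptyMove c' d
  nonempty-move-≗ {c} {c'} {d} c≗c' (partial , i , pi) =
    partial' , i , trans pi (cong suc (c≗c' i))
    where
    partial' : PartialMove c' d
    partial' j with partial j
    ... | inj₁ dj = inj₁ (trans dj (c≗c' j))
    ... | inj₂ (dj , k , k≢j , same) =
      inj₂ (trans dj (cong suc (c≗c' j)) , conflict-persists k≢j same (sym (c≗c' k)) (sym (c≗c' j)))

  settled : ∀ {c d} → PartialMove c d → ¬ ∃ (Pending c d) → ∀ i → d i ≡ c i
  settled partial none i with partial i
  ... | inj₁ di       = di
  ... | inj₂ (di , _) = ⊥-elim (none (i , di))

  pending-in-conflict : ∀ {c d a} → PartialMove c d → Pending c d a → InConflict π c a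
  pending-in-conflict {a = a} partial pa with partial a
  ... | inj₁ da             = ⊥-elim (1+n≢n (trans (sym pa) da))
  ... | inj₂ (_ , conflict) = conflict

  ConflictBesides : Config n → Fin n → Fin n → Set
  ConflictBesides c a b = ∃[ k ] (k ≢ b × k ≢ a × chair π c k ≡ chair π c b)

  move-alone : ∀ {c d a} → PartialMove c d → Pending c d a →
               (∀ b → Pending c d b → b ≢ a → ConflictBesides c a b) →
               Σ (Config n) λ c' → PairStep π c c' × PartialMove c' d
  move-alone {c} {d} {a} partial pa others with pending-in-conflict partial pa
  ... | j , j≢a , same = c₁ , (a , j , j≢a ∘ sym , sym same , inj₁ (λ _ → refl)) , partial₁
    where
    c₁ : Config n
    c₁ = advance π c (single π a)
    stays : ∀ {i} → i ≢ a → c₁ i ≡ c i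
    stays {i} i≢a = advance-out c (single π a) i (single-outside i≢a)
    partial₁ : PartialMove c₁ d
    partial₁ i with toSum (i ≟ a)
    ... | inj₁ refl = inj₁ (trans pa (sym (advance-in c (single π a) a (single-self a))))
    ... | inj₂ i≢a with partial i
    ...   | inj₁ di       = inj₁ (trans di (sym (stays i≢a)))
    ...   | inj₂ (di , _) with others i di i≢a
    ...     | k , k≢i , k≢a , same' =
      inj₂ (trans di (cong suc (sym (stays i≢a))) , conflict-persists k≢i same' (stays k≢a) (stays i≢a))

  -- If a pending b ≠ a conflicts with nobody but a, then a and b share a
  -- chair, and moving both preserves the partial move: no remaining pending
  -- player can have lost its partner, since it would conflict with b.
  move-both : ∀ {c d a b} → PartialMove c d → Pending c d a → Pending c d b → b ≢ a →
              ¬ ConflictBesides c a b → Σ (Config n) λ c' → PairStep π c c' × PartialMove c' d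
  move-both {c} {d} {a} {b} partial pa pb b≢a lonely =
    c₂ , (a , b , b≢a ∘ sym , same-ab , inj₂ (inj₂ (λ _ → refl))) , partial₂
    where
    same-ab : chair π c a ≡ chair π c b
    same-ab with pending-in-conflict partial pb
    ... | k , k≢b , same with k ≟ a
    ...   | yes refl = same
    ...   | no k≢a   = ⊥-elim (lonely (k , k≢b , k≢a , same))
    c₂ : Config n
    c₂ = advance π c (pair π a b)
    stays : ∀ {i} → i ≢ a → i ≢ b → c₂ i ≡ c i
    stays {i} i≢a i≢b = advance-out c (pair π a b) i (pair-outside i≢a i≢b)
    partial₂ : PartialMove c₂ d
    partial₂ i with toSum (i ≟ a) | toSum (i ≟ b)
    ... | inj₁ refl | _         = inj₁ (trans pa (sym (advance-in c (pair π a b) a (pair-left a b))))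
    ... | inj₂ _    | inj₁ refl = inj₁ (trans pb (sym (advance-in c (pair π a b) b (pair-right a b))))
    ... | inj₂ i≢a  | inj₂ i≢b with partial i
    ...   | inj₁ di = inj₁ (trans di (sym (stays i≢a i≢b)))
    ...   | inj₂ (di , k , k≢i , same) =
      inj₂ (trans di (cong suc (sym (stays i≢a i≢b))) , conflict-persists k≢i same (stays k≢a k≢b) (stays i≢a i≢b))
      where
      k≢a : k ≢ a
      k≢a refl = lonely (i , i≢b , i≢a , trans (sym same) same-ab)
      k≢b : k ≢ b
      k≢b refl = lonely (i , i≢b , i≢a , sym same)

  conflict-besides? : ∀ c a b → Dec (ConflictBesides c a b)
  conflict-besides? c a b =
    any? λ k → ¬? (k ≟ b) ×-dec ¬? (k ≟ a) ×-dec (chair π c k ≟ chair π c b)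

  pair-step-towards : ∀ {c d a} → PartialMove c d → Pending c d a →
                      Σ (Config n) λ c' → PairStep π c c' × PartialMove c' d
  pair-step-towards {c} {d} {a} partial pa
    with any? (λ b → (d b ≟ℕ suc (c b)) ×-dec ¬? (b ≟ a) ×-dec ¬? (conflict-besides? c a b))
  ... | yes (b , pb , b≢a , lonely) = move-both partial pa pb b≢a lonely
  ... | no none = move-alone partial pa λ b pb b≢a →
    decidable-stable (conflict-besides? c a b) (λ lonely → none (b , pb , b≢a , lonely))

  module Simulation (e : ℕ → Config n) (steps : ∀ t → ImmStep π (e t) (e (suc t))) where

    Within : Config n → Set
    Within c = ∃[ t ] NonemptyMove c (e (suc t))

    -- After a pairwise step inside step t, either players are still pending
    -- or c has reached e (suc t) and the nonempty step suc t takes over.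
    resume : ∀ {c} t → PartialMove c (e (suc t)) → Within c
    resume {c} t partial with any? (λ i → e (suc t) i ≟ℕ suc (c i))
    ... | yes pending = t , partial , pending
    ... | no none     = suc t , nonempty-move-≗ (settled partial none) (imm-nonempty-move (steps (suc t)))

    next : ∀ {c} → Within c → Σ (Config n) λ c' → PairStep π c c' × Within c'
    next (t , partial , a , pa) with pair-step-towards partial pa
    ... | c' , step , partial' = c' , step , resume t partial'

    start : Within (e 0)
    start = 0 , imm-nonempty-move (steps 0)

  immediate⇒pairwise : ImmediateWins π → PairwiseWins π
  immediate⇒pairwise (e , steps , _) = pairwise-run-wins (infinite-run Within next start)
    where open Simulation e steps

  pairwise⇒immediate : PairwiseWins π → ImmediateWins π
  pairwise⇒immediate (e , steps , not-free) = e , pair-step⇒imm-step ∘ steps , not-free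

proposition1 : (n m : ℕ) (π : Strategy n m) → ImmediateWins π ⇔ PairwiseWins π
proposition1 n m π = mk⇔ (immediate⇒pairwise π) (pairwise⇒immediate π)
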